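{- For every constant $d>0$ there is a constant $c>0$ such that the following holds for all integers $n\ge 2$, $1\le w\le n$, and $k\ge 1$. Let $\psi_1,\dots,\psi_R$, with $R=\lceil c\log_2 n\rceil$, be independent random $k$-bin hashes (each with its own independent uniformly random $h_1:[w]\to[k]$, $h_2:[n]\to[k]$), and let $\psi$ be the partial-assignment algorithm that applies $\psi_1,\psi_2,\dots,\psi_R$ in sequence, each acting on the worker/task output of the previous one. Then with probability at least $1-n^{ -d}$, $\psi$ is $k$-halving, i.e. simultaneously for every worker/task input $(W,T)$ with $|W|=|T|\le 1.1k$, the worker/task output $(W',T')$ of $\psi(W,T)$ satisfies $|W'|=|T'|\le k$.
   Context: A worker/task input is a pair $(W,T)$ with $W\subseteq[w]$, $T\subseteq[n]$, $|W|=|T|$. A partial-assignment algorithm maps each worker/task input to a matching between a subset of $W$ and a subset of $T$; the unmatched elements form the worker/task output $(W',T')$. Given $h_1:[w]\to[k]$, $h_2:[n]\to[k]$, the $k$-bin hash places each $\omega\in W$ in bin $h_1(\omega)$ and each $\tau\in T$ in bin $h_2(\tau)$, and in each bin containing at least one worker and one task matches the smallest such worker to the smallest such task. Applying algorithms in sequence means the output of one is the input of the next, and the matchings made are the union of the matchings of each step. -}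

module Defs where

open import Data.Nat using (ℕ; zero; suc; _+_; _*_; _^_; _≤_; _<_)
open import Data.Bool using (Bool; true; false; _∧_; _∨_; not)
open import Data.Fin using (Fin; zero; suc; _<?_)
open import Data.Fin.Properties using (_≟_)
open import Data.Fin.Subset using (Subset; ∣_∣)
open import Data.Vec using (Vec; []; _∷_; lookup; tabulate)
open import Data.Product using (_×_; _,_; proj₁; proj₂)
open import Relation.Nullary.Decidable using (⌊_⌋)
open import Function using (_∘_)

-- Workers are Fin w, tasks Fin n, bins Fin k.
-- A k-bin hash is a pair (h₁ , h₂) of functions [w] → [k], [n] → [k],
-- represented as vectors (tables of values) so that equality is intensional-safe.
HashPair : ℕ → ℕ → ℕ → Set
HashPair w n k = Vec (Fin k) w × Vec (Fin k) n

anyB : ∀ {m} → (Fin m → Bool) → Bool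
anyB {zero}  f = false
anyB {suc m} f = f zero ∨ anyB (f ∘ suc)

WT : ℕ → ℕ → Set
WT w n = Subset w × Subset n

matchedW : ∀ {w n k} → HashPair w n k → WT w n → Fin w → Bool
matchedW (h₁ , h₂) (W , T) ω =
  lookup W ω
  ∧ not (anyB (λ ω' → lookup W ω' ∧ ⌊ ω' <? ω ⌋ ∧ ⌊ lookup h₁ ω' ≟ lookup h₁ ω ⌋))
  ∧ anyB (λ τ → lookup T τ ∧ ⌊ lookup h₂ τ ≟ lookup h₁ ω ⌋)

matchedT : ∀ {w n k} → HashPair w n k → WT w n → Fin n → Bool
matchedT (h₁ , h₂) (W , T) τ =
  lookup T τ
  ∧ not (anyB (λ τ' → lookup T τ' ∧ ⌊ τ' <? τ ⌋ ∧ ⌊ lookup h₂ τ' ≟ lookup h₂ τ ⌋))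
  ∧ anyB (λ ω → lookup W ω ∧ ⌊ lookup h₁ ω ≟ lookup h₂ τ ⌋)

hashStep : ∀ {w n k} → HashPair w n k → WT w n → WT w n
hashStep ψ (W , T) =
  tabulate (λ ω → lookup W ω ∧ not (matchedW ψ (W , T) ω)) ,
  tabulate (λ τ → lookup T τ ∧ not (matchedT ψ (W , T) τ))

runSeq : ∀ {w n k R} → Vec (HashPair w n k) R → WT w n → WT w n
runSeq []       s = s
runSeq (ψ ∷ ψs) s = runSeq ψs (hashStep ψ s)

KHalving : ∀ {w n k R} → Vec (HashPair w n k) R → Set
KHalving {w} {n} {k} ψs =
  (W : Subset w) (T : Subset n) → ∣ W ∣ ≡ ∣ T ∣ → 10 * ∣ W ∣ ≤ 11 * k →
  ∣ proj₁ (runSeq ψs (W , T)) ∣ ≡ ∣ proj₂ (runSeq ψs (W , T)) ∣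
  × ∣ proj₁ (runSeq ψs (W , T)) ∣ ≤ k
  where open import Relation.Binary.PropositionalEquality using (_≡_)

-- R = ⌈ c · log₂ n ⌉ for c = a / b: R is the least natural number with
-- R ≥ (a/b) log₂ n, i.e. with n^a ≤ 2^(R·b).
IsCeilCLog : ℕ → ℕ → ℕ → ℕ → Set
IsCeilCLog a b n R = (n ^ a ≤ 2 ^ (R * b)) × (∀ R' → n ^ a ≤ 2 ^ (R' * b) → R ≤ R')

-- Let t = k + 1.  If ψ₁ … ψ_R is not k-halving, some (W , T) with |W| = |T| ≤ 1.1k
-- keeps t workers A and t tasks B unmatched throughout.  One k-bin hash makes as many
-- matches as there are bins holding both a worker and a task, so in every round fewer
-- than k/10 bins receive both A and B.  Colouring the bins "both / workers only / no
-- workers" gives a certificate (A , B , colourings) with which the sequence is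
-- compatible.  For a fixed certificate at most a fraction (121/400)^t of the hash
-- pairs of a round is compatible (AM-GM), and there are ≤ n^t · n^t · (3^k)^R
-- certificates; as (363/400)^8 ≤ 1/2 and n^(16+8p) ≤ 2^R, the bad fraction is ≤ n^(-p/q).
module Submission where

open import Defs
open import Data.Nat using (ℕ; _*_; _^_; _≤_)
open import Data.Vec using (Vec)
open import Data.Product using (_×_; ∃-syntax)
open import Data.List using (List; length)
open import Data.List.Membership.Propositional using (_∈_)
open import Data.List.Relation.Unary.Unique.Propositional using (Unique)
open import Relation.Nullary using (¬_)
open import Data.Nat using (zero; suc; _+_; z≤n; s≤s; NonZero; >-nonZero; _≤ᵇ_)
open import Data.Nat.Properties hiding (_≟_; _<?_)
open import Data.Nat.Tactic.RingSolver using (solve-∀)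
open import Data.Bool using (Bool; true; false; _∧_; _∨_; not; T)
open import Data.Bool.Properties using (∧-zeroʳ)
open import Data.Fin using (Fin; zero; suc; _<?_)
open import Data.Fin.Properties using (_≟_)
open import Data.Fin.Subset using (Subset; ∣_∣)
open import Data.Vec using ([]; _∷_; lookup; tabulate)
open import Data.Vec.Properties using (lookup∘tabulate; ∷-injectiveˡ; ∷-injectiveʳ)
open import Data.List using ([]; _∷_; _++_; map; filter; cartesianProductWith; cartesianProduct; allFin)
import Data.List as Lst
open import Data.List.Properties using (length-++; length-map; length-tabulate; length-filter)
open import Data.List.Relation.Unary.Any using (here; there)
open import Data.List.Relation.Unary.All using ([])
open import Data.List.Relation.Unary.AllPairs using ([]; _∷_)
open import Data.List.Membership.Propositional.Properties
  using (∈-++⁺ˡ; ∈-++⁺ʳ; ∈-++⁻; ∈-map⁺; ∈-map⁻; ∈-filter⁺; ∈-filter⁻; ∈-allFin;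
         ∈-cartesianProduct⁺; ∈-cartesianProduct⁻; ∈-cartesianProductWith⁺; ∈-cartesianProductWith⁻)
import Data.List.Relation.Unary.Unique.Propositional.Properties as Uniqueₚ
open import Data.Product using (_,_; proj₁; proj₂; Σ)
open import Data.Sum using (inj₁; inj₂)
open import Data.Unit using (tt)
open import Function using (_∘_; id)
open import Relation.Binary.PropositionalEquality
open import Relation.Nullary using (contradiction)
open import Relation.Nullary.Decidable using (⌊_⌋; yes; no; Dec; does; _because_; T?)

ind : Bool → ℕ
ind true  = 1
ind false = 0

ind-mono : ∀ {a b} → (a ≡ true → b ≡ true) → ind a ≤ ind b
ind-mono {false} a⇒b = z≤n
ind-mono {true}  a⇒b rewrite a⇒b refl = ≤-refl

sumFin : ∀ {m} → (Fin m → ℕ) → ℕ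
sumFin {zero}  f = 0
sumFin {suc m} f = f zero + sumFin (f ∘ suc)

sumFin-cong : ∀ {m} (f g : Fin m → ℕ) → (∀ i → f i ≡ g i) → sumFin f ≡ sumFin g
sumFin-cong {zero}  f g f≡g = refl
sumFin-cong {suc m} f g f≡g = cong₂ _+_ (f≡g zero) (sumFin-cong (f ∘ suc) (g ∘ suc) (f≡g ∘ suc))

sumFin-mono : ∀ {m} (f g : Fin m → ℕ) → (∀ i → f i ≤ g i) → sumFin f ≤ sumFin g
sumFin-mono {zero}  f g f≤g = z≤n
sumFin-mono {suc m} f g f≤g = +-mono-≤ (f≤g zero) (sumFin-mono (f ∘ suc) (g ∘ suc) (f≤g ∘ suc))

sumFin-zero : ∀ {m} (f : Fin m → ℕ) → (∀ i → f i ≡ 0) → sumFin f ≡ 0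
sumFin-zero {zero}  f f≡0 = refl
sumFin-zero {suc m} f f≡0 rewrite f≡0 zero = sumFin-zero (f ∘ suc) (f≡0 ∘ suc)

sumFin-const : ∀ m → sumFin {m} (λ _ → 1) ≡ m
sumFin-const zero    = refl
sumFin-const (suc m) = cong suc (sumFin-const m)

sumFin-+ : ∀ {m} (f g : Fin m → ℕ) → sumFin (λ i → f i + g i) ≡ sumFin f + sumFin g
sumFin-+ {zero}  f g = refl
sumFin-+ {suc m} f g rewrite sumFin-+ (f ∘ suc) (g ∘ suc) =
  interchange (f zero) (g zero) (sumFin (f ∘ suc)) (sumFin (g ∘ suc))
  where
  interchange : ∀ a b c d → a + b + (c + d) ≡ a + c + (b + d)
  interchange = solve-∀

sumFin-*ˡ : ∀ {m} (c : ℕ) (f : Fin m → ℕ) → sumFin (λ i → c * f i) ≡ c * sumFin f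
sumFin-*ˡ {zero}  c f = sym (*-zeroʳ c)
sumFin-*ˡ {suc m} c f rewrite sumFin-*ˡ c (f ∘ suc) = sym (*-distribˡ-+ c (f zero) _)

sumFin-*ʳ : ∀ {m} (c : ℕ) (f : Fin m → ℕ) → sumFin (λ i → f i * c) ≡ sumFin f * c
sumFin-*ʳ c f =
  trans (sumFin-cong _ _ (λ i → *-comm (f i) c)) (trans (sumFin-*ˡ c f) (*-comm c _))

sumFin-swap : ∀ {m l} (f : Fin m → Fin l → ℕ) →
  sumFin (λ i → sumFin (λ j → f i j)) ≡ sumFin (λ j → sumFin (λ i → f i j))
sumFin-swap {zero}  {l} f = sym (sumFin-zero {l} (λ j → 0) (λ _ → refl))
sumFin-swap {suc m} {l} f rewrite sumFin-swap (f ∘ suc) =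
  sym (sumFin-+ (f zero) (λ j → sumFin (λ i → f (suc i) j)))

-- ⌊_⌋ agrees with 'does'; this lets comparisons of successors compute.
⌊⌋≡does : ∀ {a} {A : Set a} (d : Dec A) → ⌊ d ⌋ ≡ does d
⌊⌋≡does (true  because _) = refl
⌊⌋≡does (false because _) = refl

<?-suc : ∀ {m} (a b : Fin m) → ⌊ suc a <? suc b ⌋ ≡ ⌊ a <? b ⌋
<?-suc a b = trans (⌊⌋≡does (suc a <? suc b)) (sym (⌊⌋≡does (a <? b)))

≟-suc : ∀ {m} (a b : Fin m) → ⌊ suc a ≟ suc b ⌋ ≡ ⌊ a ≟ b ⌋
≟-suc a b = trans (⌊⌋≡does (suc a ≟ suc b)) (sym (⌊⌋≡does (a ≟ b)))

≟-refl : ∀ {k} (x : Fin k) → ⌊ x ≟ x ⌋ ≡ true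
≟-refl x with x ≟ x
... | yes _  = refl
... | no x≢x = contradiction refl x≢x

sumFin-point : ∀ {k} (x : Fin k) → sumFin (λ b → ind ⌊ x ≟ b ⌋) ≡ 1
sumFin-point {suc k} zero    = cong suc (sumFin-zero {k} _ (λ _ → refl))
sumFin-point {suc k} (suc x) =
  trans (sumFin-cong _ _ (λ b → cong ind (≟-suc x b))) (sumFin-point {k} x)

anyB-cong : ∀ {m} (f g : Fin m → Bool) → (∀ i → f i ≡ g i) → anyB f ≡ anyB g
anyB-cong {zero}  f g f≡g = refl
anyB-cong {suc m} f g f≡g = cong₂ _∨_ (f≡g zero) (anyB-cong (f ∘ suc) (g ∘ suc) (f≡g ∘ suc))

anyB-false : ∀ {m} (f : Fin m → Bool) → (∀ i → f i ≡ false) → anyB f ≡ false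
anyB-false {zero}  f f≡false = refl
anyB-false {suc m} f f≡false rewrite f≡false zero = anyB-false (f ∘ suc) (f≡false ∘ suc)

anyB-intro : ∀ {m} (f : Fin m → Bool) (i : Fin m) → f i ≡ true → anyB f ≡ true
anyB-intro f zero    fi rewrite fi = refl
anyB-intro f (suc i) fi with f zero
... | true  = refl
... | false = anyB-intro (f ∘ suc) i fi

anyB-mono : ∀ {m} (f g : Fin m → Bool) → (∀ i → f i ≡ true → g i ≡ true) →
  anyB f ≡ true → anyB g ≡ true
anyB-mono {suc m} f g f⇒g any-f with f zero in f0
... | true rewrite f⇒g zero f0 = refl
... | false with g zero
...   | true  = refl
...   | false = anyB-mono (f ∘ suc) (g ∘ suc) (f⇒g ∘ suc) any-f

count-first : ∀ {m} (P : Fin m → Bool) →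
  sumFin (λ ω → ind (P ω ∧ not (anyB (λ ω' → P ω' ∧ ⌊ ω' <? ω ⌋)))) ≡ ind (anyB P)
count-first {zero}  P = refl
count-first {suc m} P with P zero
... | true rewrite anyB-false (λ ω' → P (suc ω') ∧ false) (λ i → ∧-zeroʳ (P (suc i))) =
  cong suc (sumFin-zero _ (λ j → cong ind (∧-zeroʳ (P (suc j)))))
... | false =
  trans (sumFin-cong _ _ (λ j → cong (λ z → ind (P (suc j) ∧ not z))
           (anyB-cong _ _ (λ j' → cong (P (suc j') ∧_) (<?-suc j' j)))))
        (count-first (P ∘ suc))

-- One k-bin hash: the number of matches is the number of shared bins

-- Workers use (X , Y , f , g) = (W , T , h₁ , h₂); tasks use the mirror image.
module OneSide {m l k : ℕ} (X : Fin m → Bool) (Y : Fin l → Bool)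
               (f : Fin m → Fin k) (g : Fin l → Fin k) where

  inBinX : Fin k → Fin m → Bool
  inBinX b x = X x ∧ ⌊ f x ≟ b ⌋

  inBinY : Fin k → Fin l → Bool
  inBinY b y = Y y ∧ ⌊ g y ≟ b ⌋

  matched : Fin m → Bool
  matched x = X x ∧ not (anyB (λ x' → X x' ∧ ⌊ x' <? x ⌋ ∧ ⌊ f x' ≟ f x ⌋))
                  ∧ anyB (λ y → Y y ∧ ⌊ g y ≟ f x ⌋)

  reorder : ∀ u v z → u ∧ v ∧ z ≡ (u ∧ z) ∧ v
  reorder true  true  true  = refl
  reorder true  true  false = refl
  reorder true  false z     = sym (∧-zeroʳ z)
  reorder false v     z     = refl

  regroup : ∀ a u v → ind (a ∧ not u ∧ v) * 1 ≡ ind ((a ∧ true) ∧ not u) * ind v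
  regroup true  true  v = refl
  regroup true  false v = trans (*-identityʳ _) (sym (+-identityʳ _))
  regroup false u     v = refl

  matched-in-bin : ∀ x b → ind (matched x) * ind ⌊ f x ≟ b ⌋ ≡
    ind (inBinX b x ∧ not (anyB (λ x' → inBinX b x' ∧ ⌊ x' <? x ⌋))) * ind (anyB (inBinY b))
  matched-in-bin x b with f x ≟ b
  ... | no _ rewrite ∧-zeroʳ (X x) = *-zeroʳ (ind (matched x))
  ... | yes refl rewrite anyB-cong (λ x' → X x' ∧ ⌊ x' <? x ⌋ ∧ ⌊ f x' ≟ f x ⌋)
                                   (λ x' → (X x' ∧ ⌊ f x' ≟ f x ⌋) ∧ ⌊ x' <? x ⌋)
                                   (λ x' → reorder (X x') _ _) = regroup (X x) _ _

  matched-count : sumFin (λ x → ind (matched x)) ≡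
                  sumFin (λ b → ind (anyB (inBinX b)) * ind (anyB (inBinY b)))
  matched-count = begin
    sumFin (λ x → ind (matched x))
      ≡⟨ sumFin-cong _ _ (λ x → sym (spread x)) ⟩
    sumFin (λ x → sumFin (λ b → ind (matched x) * ind ⌊ f x ≟ b ⌋))
      ≡⟨ sumFin-swap (λ x b → ind (matched x) * ind ⌊ f x ≟ b ⌋) ⟩
    sumFin (λ b → sumFin (λ x → ind (matched x) * ind ⌊ f x ≟ b ⌋))
      ≡⟨ sumFin-cong _ _ (λ b → trans (sumFin-cong _ _ (λ x → matched-in-bin x b))
                                 (trans (sumFin-*ʳ {m} _ _)
                                        (cong (_* ind (anyB (inBinY b))) (count-first (inBinX b))))) ⟩
    sumFin (λ b → ind (anyB (inBinX b)) * ind (anyB (inBinY b))) ∎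
    where
    open ≡-Reasoning
    spread : ∀ x → sumFin (λ b → ind (matched x) * ind ⌊ f x ≟ b ⌋) ≡ ind (matched x)
    spread x = trans (sumFin-*ˡ (ind (matched x)) (λ b → ind ⌊ f x ≟ b ⌋))
                     (trans (cong (ind (matched x) *_) (sumFin-point (f x))) (*-identityʳ _))

sharedBins : ∀ {w n k} → Vec (Fin k) w → Vec (Fin k) n → Subset w → Subset n → ℕ
sharedBins h₁ h₂ A B = sumFin (λ b → ind (anyB (λ ω → lookup A ω ∧ ⌊ lookup h₁ ω ≟ b ⌋))
                                    * ind (anyB (λ τ → lookup B τ ∧ ⌊ lookup h₂ τ ≟ b ⌋)))

-- Inclusion of subsets, pointwise on their characteristic vectors (a record, so
-- that the two sets can be inferred from an inclusion proof).
record _⊆_ {m} (A W : Subset m) : Set where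
  constructor ⊆-intro
  field ⊆-elim : ∀ i → lookup A i ≡ true → lookup W i ≡ true
open _⊆_

⊆-refl : ∀ {m} {A : Subset m} → A ⊆ A
⊆-refl = ⊆-intro (λ i i∈A → i∈A)

⊆-trans : ∀ {m} {A B C : Subset m} → A ⊆ B → B ⊆ C → A ⊆ C
⊆-trans A⊆B B⊆C = ⊆-intro (λ i i∈A → ⊆-elim B⊆C i (⊆-elim A⊆B i i∈A))

sharedBins-mono : ∀ {w n k} (h₁ : Vec (Fin k) w) (h₂ : Vec (Fin k) n) {A W : Subset w} {B T : Subset n} →
  A ⊆ W → B ⊆ T → sharedBins h₁ h₂ A B ≤ sharedBins h₁ h₂ W T
sharedBins-mono h₁ h₂ {A} {W} {B} {T} A⊆W B⊆T = sumFin-mono _ _ (λ b →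
  *-mono-≤ (ind-mono (anyB-mono _ _ (λ ω → restrict A W A⊆W ω (lookup h₁ ω) b)))
           (ind-mono (anyB-mono _ _ (λ τ → restrict B T B⊆T τ (lookup h₂ τ) b))))
  where
  restrict : ∀ {m k} (A W : Subset m) → A ⊆ W → ∀ i (x b : Fin k) →
             lookup A i ∧ ⌊ x ≟ b ⌋ ≡ true → lookup W i ∧ ⌊ x ≟ b ⌋ ≡ true
  restrict A W A⊆W i x b i∈A with lookup A i in eq
  ... | true rewrite ⊆-elim A⊆W i eq = i∈A

keep-or-match : ∀ a r → ind a ≡ ind (a ∧ not (a ∧ r)) + ind (a ∧ r)
keep-or-match true  true  = refl
keep-or-match true  false = refl
keep-or-match false r     = refl

∣∣-sum : ∀ {m} (V : Vec Bool m) → ∣ V ∣ ≡ sumFin (λ i → ind (lookup V i))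
∣∣-sum []          = refl
∣∣-sum (true  ∷ V) = cong suc (∣∣-sum V)
∣∣-sum (false ∷ V) = ∣∣-sum V

∣tabulate∣ : ∀ {m} (f : Fin m → Bool) → ∣ tabulate f ∣ ≡ sumFin (λ i → ind (f i))
∣tabulate∣ {zero}  f = refl
∣tabulate∣ {suc m} f with f zero
... | true  = cong suc (∣tabulate∣ (f ∘ suc))
... | false = ∣tabulate∣ (f ∘ suc)

removal-count : ∀ {m} (X : Subset m) (r : Fin m → Bool) →
  ∣ X ∣ ≡ ∣ tabulate (λ i → lookup X i ∧ not (lookup X i ∧ r i)) ∣ + sumFin (λ i → ind (lookup X i ∧ r i))
removal-count X r = begin
  ∣ X ∣                                                   ≡⟨ ∣∣-sum X ⟩
  sumFin (λ i → ind (lookup X i))                         ≡⟨ sumFin-cong _ _ (λ i → keep-or-match (lookup X i) (r i)) ⟩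
  sumFin (λ i → ind (kept i) + ind (lookup X i ∧ r i))    ≡⟨ sumFin-+ (ind ∘ kept) (λ i → ind (lookup X i ∧ r i)) ⟩
  sumFin (λ i → ind (kept i)) + sumFin (λ i → ind (lookup X i ∧ r i))
                                                          ≡⟨ cong (_+ sumFin (λ i → ind (lookup X i ∧ r i))) (sym (∣tabulate∣ kept)) ⟩
  ∣ tabulate kept ∣ + sumFin (λ i → ind (lookup X i ∧ r i)) ∎
  where
  open ≡-Reasoning
  kept : Fin _ → Bool
  kept i = lookup X i ∧ not (lookup X i ∧ r i)

tabulate-⊆ : ∀ {m} (X : Subset m) (r : Fin m → Bool) → tabulate (λ i → lookup X i ∧ r i) ⊆ X
tabulate-⊆ X r = ⊆-intro kept
  where
  kept : ∀ i → lookup (tabulate (λ i → lookup X i ∧ r i)) i ≡ true → lookup X i ≡ true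
  kept i i∈ rewrite lookup∘tabulate (λ i → lookup X i ∧ r i) i with lookup X i
  ... | true  = refl
  ... | false = i∈

module Round {w n k} (h₁ : Vec (Fin k) w) (h₂ : Vec (Fin k) n) (W : Subset w) (T : Subset n) where
  module Workers = OneSide (lookup W) (lookup T) (lookup h₁) (lookup h₂)
  module Tasks   = OneSide (lookup T) (lookup W) (lookup h₂) (lookup h₁)

  W′ : Subset w
  W′ = proj₁ (hashStep (h₁ , h₂) (W , T))
  T′ : Subset n
  T′ = proj₂ (hashStep (h₁ , h₂) (W , T))

  workers-split : ∣ W ∣ ≡ ∣ W′ ∣ + sharedBins h₁ h₂ W T
  workers-split = trans (removal-count W _) (cong (∣ W′ ∣ +_) Workers.matched-count)

  tasks-split : ∣ T ∣ ≡ ∣ T′ ∣ + sharedBins h₁ h₂ W T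
  tasks-split = trans (removal-count T _) (cong (∣ T′ ∣ +_)
    (trans Tasks.matched-count (sumFin-cong {k} _ _ (λ b → *-comm (ind (anyB (Tasks.inBinX b))) _))))

  W′⊆W : W′ ⊆ W
  W′⊆W = tabulate-⊆ W _

  T′⊆T : T′ ⊆ T
  T′⊆T = tabulate-⊆ T _

  W′-shrinks : ∣ W′ ∣ ≤ ∣ W ∣
  W′-shrinks = subst (∣ W′ ∣ ≤_) (sym workers-split) (m≤m+n _ _)

finalW : ∀ {w n k R} → Vec (HashPair w n k) R → WT w n → Subset w
finalW ψs s = proj₁ (runSeq ψs s)

finalT : ∀ {w n k R} → Vec (HashPair w n k) R → WT w n → Subset n
finalT ψs s = proj₂ (runSeq ψs s)

-- Each round removes as many workers as tasks, so balanced inputs stay balanced.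
run-balanced : ∀ {w n k R} (ψs : Vec (HashPair w n k) R) (W : Subset w) (T : Subset n) →
  ∣ W ∣ ≡ ∣ T ∣ → ∣ finalW ψs (W , T) ∣ ≡ ∣ finalT ψs (W , T) ∣
run-balanced []                W T eq = eq
run-balanced ((h₁ , h₂) ∷ ψs) W T eq = run-balanced ψs Rd.W′ Rd.T′
  (+-cancelʳ-≡ _ _ _ (trans (sym Rd.workers-split) (trans eq Rd.tasks-split)))
  where module Rd = Round h₁ h₂ W T

run-⊆ : ∀ {w n k R} (ψs : Vec (HashPair w n k) R) (W : Subset w) (T : Subset n) →
  finalW ψs (W , T) ⊆ W × finalT ψs (W , T) ⊆ T
run-⊆ []                W T = ⊆-refl , ⊆-refl
run-⊆ ((h₁ , h₂) ∷ ψs) W T =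
  ⊆-trans (proj₁ (run-⊆ ψs Rd.W′ Rd.T′)) Rd.W′⊆W ,
  ⊆-trans (proj₂ (run-⊆ ψs Rd.W′ Rd.T′)) Rd.T′⊆T
  where module Rd = Round h₁ h₂ W T

run-shrinks : ∀ {w n k R} (ψs : Vec (HashPair w n k) R) (W : Subset w) (T : Subset n) →
  ∣ finalW ψs (W , T) ∣ ≤ ∣ W ∣
run-shrinks []                W T = ≤-refl
run-shrinks ((h₁ , h₂) ∷ ψs) W T = ≤-trans (run-shrinks ψs Rd.W′ Rd.T′) Rd.W′-shrinks
  where module Rd = Round h₁ h₂ W T

-- Colourings of the bins and certificates of failure

-- A bin is coloured by whether it receives an element of A and one of B:
-- 'both', 'workersOnly' (A but not B), or 'noWorkers' (no element of A).
data Colour : Set where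
  both workersOnly noWorkers : Colour

classify : (hasWorker hasTask : Bool) → Colour
classify true  true  = both
classify true  false = workersOnly
classify false _     = noWorkers

isBoth workerAllowed taskAllowed : Colour → Bool
isBoth both = true
isBoth _    = false
workerAllowed noWorkers = false
workerAllowed _         = true
taskAllowed workersOnly = false
taskAllowed _           = true

allowed-sum : ∀ c → ind (workerAllowed c) + ind (taskAllowed c) ≡ 1 + ind (isBoth c)
allowed-sum both        = refl
allowed-sum workersOnly = refl
allowed-sum noWorkers   = refl

bothCount : ∀ {k} → Vec Colour k → ℕ
bothCount c = sumFin (λ b → ind (isBoth (lookup c b)))

allAllowed : ∀ {m k} → Subset m → (Fin k → Bool) → Vec (Fin k) m → Bool
allAllowed []          ok []      = true
allAllowed (a ∷ A) ok (x ∷ h) = (not a ∨ ok x) ∧ allAllowed A ok h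

allAllowed-intro : ∀ {m k} (A : Subset m) (ok : Fin k → Bool) (h : Vec (Fin k) m) →
  (∀ i → lookup A i ≡ true → ok (lookup h i) ≡ true) → allAllowed A ok h ≡ true
allAllowed-intro []          ok []      p = refl
allAllowed-intro (true ∷ A)  ok (x ∷ h) p rewrite p zero refl = allAllowed-intro A ok h (p ∘ suc)
allAllowed-intro (false ∷ A) ok (x ∷ h) p = allAllowed-intro A ok h (p ∘ suc)

roundCompatible : ∀ {w n k} → Subset w → Subset n → Vec Colour k → HashPair w n k → Bool
roundCompatible A B c (h₁ , h₂) =
  allAllowed A (workerAllowed ∘ lookup c) h₁ ∧ allAllowed B (taskAllowed ∘ lookup c) h₂

compatible : ∀ {w n k R} → Subset w → Subset n → Vec (HashPair w n k) R → Vec (Vec Colour k) R → Bool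
compatible A B []       []       = true
compatible A B (ψ ∷ ψs) (c ∷ cs) = roundCompatible A B c ψ ∧ compatible A B ψs cs

module Colouring {w n k} (h₁ : Vec (Fin k) w) (h₂ : Vec (Fin k) n) (A : Subset w) (B : Subset n) where
  hasWorker hasTask : Fin k → Bool
  hasWorker b = anyB (λ ω → lookup A ω ∧ ⌊ lookup h₁ ω ≟ b ⌋)
  hasTask   b = anyB (λ τ → lookup B τ ∧ ⌊ lookup h₂ τ ≟ b ⌋)

  colouring : Vec Colour k
  colouring = tabulate (λ b → classify (hasWorker b) (hasTask b))

  colour-at : ∀ b → lookup colouring b ≡ classify (hasWorker b) (hasTask b)
  colour-at = lookup∘tabulate (λ b → classify (hasWorker b) (hasTask b))

  bothCount-colouring : bothCount colouring ≡ sharedBins h₁ h₂ A B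
  bothCount-colouring = sumFin-cong _ _ (λ b → trans (cong (ind ∘ isBoth) (colour-at b))
                                                   (both-iff (hasWorker b) (hasTask b)))
    where
    both-iff : ∀ x y → ind (isBoth (classify x y)) ≡ ind x * ind y
    both-iff true  true  = refl
    both-iff true  false = refl
    both-iff false y     = refl

  own-bin : ∀ {m} (X : Subset m) (h : Vec (Fin k) m) i → lookup X i ≡ true →
    anyB (λ j → lookup X j ∧ ⌊ lookup h j ≟ lookup h i ⌋) ≡ true
  own-bin X h i i∈X =
    anyB-intro _ i (trans (cong (_∧ ⌊ lookup h i ≟ lookup h i ⌋) i∈X) (≟-refl (lookup h i)))

  workers-allowed : ∀ ω → lookup A ω ≡ true → workerAllowed (lookup colouring (lookup h₁ ω)) ≡ true
  workers-allowed ω ω∈A rewrite colour-at (lookup h₁ ω) | own-bin A h₁ ω ω∈A = by-cases (hasTask (lookup h₁ ω))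
    where
    by-cases : ∀ y → workerAllowed (classify true y) ≡ true
    by-cases true  = refl
    by-cases false = refl

  tasks-allowed : ∀ τ → lookup B τ ≡ true → taskAllowed (lookup colouring (lookup h₂ τ)) ≡ true
  tasks-allowed τ τ∈B rewrite colour-at (lookup h₂ τ) | own-bin B h₂ τ τ∈B = by-cases (hasWorker (lookup h₂ τ))
    where
    by-cases : ∀ x → taskAllowed (classify x true) ≡ true
    by-cases true  = refl
    by-cases false = refl

  colouring-compatible : roundCompatible A B colouring (h₁ , h₂) ≡ true
  colouring-compatible
    rewrite allAllowed-intro A (workerAllowed ∘ lookup colouring) h₁ workers-allowed
          | allAllowed-intro B (taskAllowed ∘ lookup colouring) h₂ tasks-allowed = refl

-- If A and B survive all rounds starting from (W , T), then the induced colourings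
-- form a compatible sequence, and in each round the 'both' bins are at most the
-- number of pairs matched in that round, hence at most |W| - |W'|.
certificate : ∀ {w n k R} (ψs : Vec (HashPair w n k) R) (W : Subset w) (T : Subset n)
  (A : Subset w) (B : Subset n) → A ⊆ finalW ψs (W , T) → B ⊆ finalT ψs (W , T) →
  Σ (Vec (Vec Colour k) R) (λ cs → (compatible A B ψs cs ≡ true) ×
     (∀ i → bothCount (lookup cs i) + ∣ finalW ψs (W , T) ∣ ≤ ∣ W ∣))
certificate []                W T A B A⊆ B⊆ = [] , refl , λ ()
certificate ((h₁ , h₂) ∷ ψs) W T A B A⊆ B⊆
  with certificate ψs Rd.W′ Rd.T′ A B A⊆ B⊆
  where module Rd = Round h₁ h₂ W T
... | cs , cs-compatible , cs-bound = C.colouring ∷ cs , compatible-∷ , bound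
  where
  module Rd = Round h₁ h₂ W T
  module C  = Colouring h₁ h₂ A B
  W″ = finalW ψs (Rd.W′ , Rd.T′)

  compatible-∷ : roundCompatible A B C.colouring (h₁ , h₂) ∧ compatible A B ψs cs ≡ true
  compatible-∷ rewrite C.colouring-compatible | cs-compatible = refl

  first-round : bothCount C.colouring + ∣ W″ ∣ ≤ ∣ W ∣
  first-round = begin
    bothCount C.colouring + ∣ W″ ∣     ≡⟨ cong (_+ ∣ W″ ∣) C.bothCount-colouring ⟩
    sharedBins h₁ h₂ A B + ∣ W″ ∣      ≤⟨ +-mono-≤ (sharedBins-mono h₁ h₂ A⊆W B⊆T)
                                                    (run-shrinks ψs Rd.W′ Rd.T′) ⟩
    sharedBins h₁ h₂ W T + ∣ Rd.W′ ∣   ≡⟨ +-comm (sharedBins h₁ h₂ W T) _ ⟩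
    ∣ Rd.W′ ∣ + sharedBins h₁ h₂ W T   ≡⟨ sym Rd.workers-split ⟩
    ∣ W ∣ ∎
    where
    open ≤-Reasoning
    A⊆W = ⊆-trans A⊆ (proj₁ (run-⊆ ((h₁ , h₂) ∷ ψs) W T))
    B⊆T = ⊆-trans B⊆ (proj₂ (run-⊆ ((h₁ , h₂) ∷ ψs) W T))

  bound : ∀ i → bothCount (lookup (C.colouring ∷ cs) i) + ∣ W″ ∣ ≤ ∣ W ∣
  bound zero    = first-round
  bound (suc i) = ≤-trans (cs-bound i) Rd.W′-shrinks

module _ {a} {A : Set a} where

  count : (A → Bool) → List A → ℕ
  count P []       = 0
  count P (x ∷ xs) = ind (P x) + count P xs

  count-++ : ∀ (P : A → Bool) xs ys → count P (xs ++ ys) ≡ count P xs + count P ys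
  count-++ P []       ys = refl
  count-++ P (x ∷ xs) ys rewrite count-++ P xs ys = sym (+-assoc (ind (P x)) _ _)

  count-cong : ∀ (P Q : A → Bool) xs → (∀ x → P x ≡ Q x) → count P xs ≡ count Q xs
  count-cong P Q []       P≡Q = refl
  count-cong P Q (x ∷ xs) P≡Q = cong₂ _+_ (cong ind (P≡Q x)) (count-cong P Q xs P≡Q)

  count-∧ : ∀ (b : Bool) (Q : A → Bool) xs → count (λ y → b ∧ Q y) xs ≡ ind b * count Q xs
  count-∧ true  Q xs       = sym (+-identityʳ _)
  count-∧ false Q []       = refl
  count-∧ false Q (x ∷ xs) = count-∧ false Q xs

  count-true : ∀ xs → count (λ _ → true) xs ≡ length xs
  count-true []       = refl
  count-true (x ∷ xs) = cong suc (count-true xs)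

  length-filter≡count : ∀ (P : A → Bool) xs → length (filter (λ x → T? (P x)) xs) ≡ count P xs
  length-filter≡count P []       = refl
  length-filter≡count P (x ∷ xs) with P x
  ... | true  = cong suc (length-filter≡count P xs)
  ... | false = length-filter≡count P xs

  count-tabulate : ∀ {m} (P : A → Bool) (f : Fin m → A) →
    count P (Lst.tabulate f) ≡ sumFin (λ i → ind (P (f i)))
  count-tabulate {zero}  P f = refl
  count-tabulate {suc m} P f = cong (ind (P (f zero)) +_) (count-tabulate P (f ∘ suc))

count-map : ∀ {a b} {A : Set a} {B : Set b} (P : B → Bool) (f : A → B) xs →
  count P (map f xs) ≡ count (P ∘ f) xs
count-map P f []       = refl
count-map P f (x ∷ xs) = cong (ind (P (f x)) +_) (count-map P f xs)

count-product : ∀ {a b c} {A : Set a} {B : Set b} {C : Set c} (F : A → B → C) (H : C → Bool)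
  (P : A → Bool) (Q : B → Bool) xs ys → (∀ x y → H (F x y) ≡ P x ∧ Q y) →
  count H (cartesianProductWith F xs ys) ≡ count P xs * count Q ys
count-product F H P Q []       ys H≡ = refl
count-product F H P Q (x ∷ xs) ys H≡ = begin
  count H (map (F x) ys ++ cartesianProductWith F xs ys)
    ≡⟨ count-++ H (map (F x) ys) _ ⟩
  count H (map (F x) ys) + count H (cartesianProductWith F xs ys)
    ≡⟨ cong₂ _+_ (trans (count-map H (F x) ys) (trans (count-cong _ _ ys (H≡ x)) (count-∧ (P x) Q ys)))
                 (count-product F H P Q xs ys H≡) ⟩
  ind (P x) * count Q ys + count P xs * count Q ys
    ≡⟨ sym (*-distribʳ-+ (count Q ys) (ind (P x)) _) ⟩
  (ind (P x) + count P xs) * count Q ys ∎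
  where open ≡-Reasoning

length-cartesianProductWith : ∀ {a b c} {A : Set a} {B : Set b} {C : Set c} (F : A → B → C) xs ys →
  length (cartesianProductWith F xs ys) ≡ length xs * length ys
length-cartesianProductWith F []       ys = refl
length-cartesianProductWith F (x ∷ xs) ys =
  trans (length-++ (map (F x) ys))
        (cong₂ _+_ (length-map (F x) ys) (length-cartesianProductWith F xs ys))

vectors : ∀ {a} {A : Set a} → List A → (m : ℕ) → List (Vec A m)
vectors xs zero    = [] ∷ []
vectors xs (suc m) = cartesianProductWith _∷_ xs (vectors xs m)

vectors-unique : ∀ {a} {A : Set a} {xs : List A} m → Unique xs → Unique (vectors xs m)
vectors-unique zero    xs! = [] ∷ []
vectors-unique (suc m) xs! =
  Uniqueₚ.cartesianProductWith⁺ _∷_ (λ eq → ∷-injectiveˡ eq , ∷-injectiveʳ eq) xs! (vectors-unique m xs!)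

vectors-complete : ∀ {a} {A : Set a} {xs : List A} {m} (v : Vec A m) →
  (∀ i → lookup v i ∈ xs) → v ∈ vectors xs m
vectors-complete []      entries = here refl
vectors-complete (x ∷ v) entries =
  ∈-cartesianProductWith⁺ _∷_ (entries zero) (vectors-complete v (entries ∘ suc))

vectors-sound : ∀ {a} {A : Set a} (xs : List A) {m} (v : Vec A m) → v ∈ vectors xs m →
  ∀ i → lookup v i ∈ xs
vectors-sound xs {suc m} v v∈ i with ∈-cartesianProductWith⁻ _∷_ xs (vectors xs m) v∈
vectors-sound xs {suc m} .(x ∷ v) v∈ zero    | x , v , x∈ , v∈′ , refl = x∈
vectors-sound xs {suc m} .(x ∷ v) v∈ (suc i) | x , v , x∈ , v∈′ , refl = vectors-sound xs v v∈′ i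

vectors-length : ∀ {a} {A : Set a} (xs : List A) m → length (vectors xs m) ≡ length xs ^ m
vectors-length xs zero    = refl
vectors-length xs (suc m) =
  trans (length-cartesianProductWith _∷_ xs (vectors xs m)) (cong (length xs *_) (vectors-length xs m))

count-vectors-∷ : ∀ {a} {A : Set a} (xs : List A) {m} (H : Vec A (suc m) → Bool)
  (P : A → Bool) (Q : Vec A m → Bool) → (∀ x v → H (x ∷ v) ≡ P x ∧ Q v) →
  count H (vectors xs (suc m)) ≡ count P xs * count Q (vectors xs m)
count-vectors-∷ xs {m} H P Q H≡ = count-product _∷_ H P Q xs (vectors xs m) H≡

-- How many hash pairs are compatible with a colouring

^-distribʳ-* : ∀ a b t → (a * b) ^ t ≡ a ^ t * b ^ t
^-distribʳ-* a b zero    = refl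
^-distribʳ-* a b (suc t) rewrite ^-distribʳ-* a b t = interchange a b (a ^ t) (b ^ t)
  where
  interchange : ∀ a b x y → a * b * (x * y) ≡ a * x * (b * y)
  interchange = solve-∀

hashPairs : (w n k : ℕ) → List (HashPair w n k)
hashPairs w n k = cartesianProduct (vectors (allFin k) w) (vectors (allFin k) n)

-- Each element of A must be sent to one of the bins where ok holds, the other
-- coordinates are free:  #{h | ok ∘ h on A} · k^|A| = |ok|^|A| · k^m.
allowed-count : ∀ {m k} (A : Subset m) (ok : Fin k → Bool) →
  count (allAllowed A ok) (vectors (allFin k) m) * k ^ ∣ A ∣ ≡ count ok (allFin k) ^ ∣ A ∣ * k ^ m
allowed-count {zero}      []          ok = refl
allowed-count {suc m} {k} (true ∷ A)  ok
  rewrite count-vectors-∷ (allFin k) (allAllowed (true ∷ A) ok) ok (allAllowed A ok) (λ x v → refl) =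
  begin
    u * G * (k * x)  ≡⟨ shuffle₁ u G k x ⟩
    u * k * (G * x)  ≡⟨ cong (u * k *_) (allowed-count A ok) ⟩
    u * k * (y * z)  ≡⟨ shuffle₂ u k y z ⟩
    u * y * (k * z)  ∎
  where
  open ≡-Reasoning
  u = count ok (allFin k)
  G = count (allAllowed A ok) (vectors (allFin k) m)
  x = k ^ ∣ A ∣
  y = u ^ ∣ A ∣
  z = k ^ m
  shuffle₁ : ∀ u G k x → u * G * (k * x) ≡ u * k * (G * x)
  shuffle₁ = solve-∀
  shuffle₂ : ∀ u k y z → u * k * (y * z) ≡ u * y * (k * z)
  shuffle₂ = solve-∀
allowed-count {suc m} {k} (false ∷ A) ok
  rewrite count-vectors-∷ (allFin k) (allAllowed (false ∷ A) ok) (λ _ → true) (allAllowed A ok) (λ x v → refl)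
        | count-true (allFin k) | length-tabulate {n = k} id =
  begin
    k * G * x        ≡⟨ *-assoc k G x ⟩
    k * (G * x)      ≡⟨ cong (k *_) (allowed-count A ok) ⟩
    k * (y * z)      ≡⟨ shuffle k y z ⟩
    y * (k * z)      ∎
  where
  open ≡-Reasoning
  G = count (allAllowed A ok) (vectors (allFin k) m)
  x = k ^ ∣ A ∣
  y = count ok (allFin k) ^ ∣ A ∣
  z = k ^ m
  shuffle : ∀ k y z → k * (y * z) ≡ y * (k * z)
  shuffle = solve-∀

workerBins taskBins : ∀ {k} → Vec Colour k → ℕ
workerBins {k} c = count (workerAllowed ∘ lookup c) (allFin k)
taskBins   {k} c = count (taskAllowed ∘ lookup c) (allFin k)

-- Only 'both' bins are counted twice.
allowed-bins-sum : ∀ {k} (c : Vec Colour k) → workerBins c + taskBins c ≡ k + bothCount c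
allowed-bins-sum {k} c = begin
  workerBins c + taskBins c
    ≡⟨ cong₂ _+_ (count-tabulate (workerAllowed ∘ lookup c) id) (count-tabulate (taskAllowed ∘ lookup c) id) ⟩
  sumFin (λ b → ind (workerAllowed (lookup c b))) + sumFin (λ b → ind (taskAllowed (lookup c b)))
    ≡⟨ sym (sumFin-+ {k} _ _) ⟩
  sumFin (λ b → ind (workerAllowed (lookup c b)) + ind (taskAllowed (lookup c b)))
    ≡⟨ sumFin-cong _ _ (λ b → allowed-sum (lookup c b)) ⟩
  sumFin (λ b → 1 + ind (isBoth (lookup c b)))
    ≡⟨ sumFin-+ {k} _ _ ⟩
  sumFin {k} (λ _ → 1) + bothCount c
    ≡⟨ cong (_+ bothCount c) (sumFin-const k) ⟩
  k + bothCount c ∎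
  where open ≡-Reasoning

am-gm : ∀ u v → 4 * (u * v) ≤ (u + v) * (u + v)
am-gm u v with ≤-total u v
... | inj₁ u≤v with m≤n⇒∃[o]m+o≡n u≤v
...   | d , refl = ≤-trans (m≤m+n (4 * (u * (u + d))) (d * d)) (≤-reflexive (square u d))
  where
  square : ∀ u d → 4 * (u * (u + d)) + d * d ≡ (u + (u + d)) * (u + (u + d))
  square = solve-∀
am-gm u v | inj₂ v≤u with m≤n⇒∃[o]m+o≡n v≤u
...   | d , refl = ≤-trans (m≤m+n (4 * ((v + d) * v)) (d * d)) (≤-reflexive (square v d))
  where
  square : ∀ v d → 4 * ((v + d) * v) + d * d ≡ (v + d + v) * (v + d + v)
  square = solve-∀

-- If u + v = k + s with s ≤ k/10 then uv ≤ (1.1k)²/4 = 121k²/400.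
product-bound : ∀ k s u v → 10 * s ≤ k → u + v ≡ k + s → 400 * (u * v) ≤ 121 * (k * k)
product-bound k s u v 10s≤k u+v≡ = begin
  400 * (u * v)                          ≡⟨ *-assoc 100 4 (u * v) ⟩
  100 * (4 * (u * v))                    ≤⟨ *-monoʳ-≤ 100 (am-gm u v) ⟩
  100 * ((u + v) * (u + v))              ≡⟨ cong (λ z → 100 * (z * z)) u+v≡ ⟩
  100 * ((k + s) * (k + s))              ≡⟨ scale k s ⟩
  (10 * k + 10 * s) * (10 * k + 10 * s)  ≤⟨ *-mono-≤ 10k+10s≤11k 10k+10s≤11k ⟩
  (10 * k + k) * (10 * k + k)            ≡⟨ eleven k ⟩
  121 * (k * k)                          ∎
  where
  open ≤-Reasoning
  10k+10s≤11k : 10 * k + 10 * s ≤ 10 * k + k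
  10k+10s≤11k = +-monoʳ-≤ (10 * k) 10s≤k
  scale : ∀ k s → 100 * ((k + s) * (k + s)) ≡ (10 * k + 10 * s) * (10 * k + 10 * s)
  scale = solve-∀
  eleven : ∀ k → (10 * k + k) * (10 * k + k) ≡ 121 * (k * k)
  eleven = solve-∀

round-count : ∀ {w n k} (A : Subset w) (B : Subset n) (c : Vec Colour k) (t : ℕ) →
  ∣ A ∣ ≡ t → ∣ B ∣ ≡ t →
  count (roundCompatible A B c) (hashPairs w n k) * (k ^ t * k ^ t)
    ≡ (workerBins c * taskBins c) ^ t * (k ^ w * k ^ n)
round-count {w} {n} {k} A B c t ∣A∣≡t ∣B∣≡t = begin
  count (roundCompatible A B c) (hashPairs w n k) * (k ^ t * k ^ t)
    ≡⟨ cong (_* (k ^ t * k ^ t)) (count-product _,_ (roundCompatible A B c) _ _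
                                     (vectors (allFin k) w) (vectors (allFin k) n) (λ _ _ → refl)) ⟩
  G₁ * G₂ * (k ^ t * k ^ t)          ≡⟨ shuffle₁ G₁ G₂ (k ^ t) ⟩
  (G₁ * k ^ t) * (G₂ * k ^ t)        ≡⟨ cong₂ _*_ workers tasks ⟩
  (u ^ t * k ^ w) * (v ^ t * k ^ n)  ≡⟨ shuffle₂ (u ^ t) (k ^ w) (v ^ t) (k ^ n) ⟩
  (u ^ t * v ^ t) * (k ^ w * k ^ n)  ≡⟨ cong (_* (k ^ w * k ^ n)) (sym (^-distribʳ-* u v t)) ⟩
  (u * v) ^ t * (k ^ w * k ^ n)      ∎
  where
  open ≡-Reasoning
  G₁ = count (allAllowed A (workerAllowed ∘ lookup c)) (vectors (allFin k) w)
  G₂ = count (allAllowed B (taskAllowed ∘ lookup c)) (vectors (allFin k) n)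
  u = workerBins c
  v = taskBins c
  workers : G₁ * k ^ t ≡ u ^ t * k ^ w
  workers = subst (λ z → G₁ * k ^ z ≡ u ^ z * k ^ w) ∣A∣≡t (allowed-count A _)
  tasks : G₂ * k ^ t ≡ v ^ t * k ^ n
  tasks = subst (λ z → G₂ * k ^ z ≡ v ^ z * k ^ n) ∣B∣≡t (allowed-count B _)
  shuffle₁ : ∀ a b x → a * b * (x * x) ≡ (a * x) * (b * x)
  shuffle₁ = solve-∀
  shuffle₂ : ∀ a b c d → (a * b) * (c * d) ≡ (a * c) * (b * d)
  shuffle₂ = solve-∀

round-bound : ∀ {w n k} .{{_ : NonZero k}} (A : Subset w) (B : Subset n) (c : Vec Colour k) (t : ℕ) →
  10 * bothCount c ≤ k → ∣ A ∣ ≡ t → ∣ B ∣ ≡ t →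
  count (roundCompatible A B c) (hashPairs w n k) * 400 ^ t ≤ 121 ^ t * (k ^ w * k ^ n)
round-bound {w} {n} {k} A B c t few-both ∣A∣≡t ∣B∣≡t =
  *-cancelʳ-≤ _ _ (X * X) {{m*n≢0 X X {{m^n≢0 k t}} {{m^n≢0 k t}}}} (begin
    C * 400 ^ t * (X * X)        ≡⟨ shuffle₁ C (400 ^ t) (X * X) ⟩
    400 ^ t * (C * (X * X))      ≡⟨ cong (400 ^ t *_) (round-count A B c t ∣A∣≡t ∣B∣≡t) ⟩
    400 ^ t * ((u * v) ^ t * K)  ≡⟨ trans (sym (*-assoc (400 ^ t) _ K))
                                          (cong (_* K) (sym (^-distribʳ-* 400 (u * v) t))) ⟩
    (400 * (u * v)) ^ t * K      ≤⟨ *-monoˡ-≤ K (^-monoˡ-≤ t (product-bound k (bothCount c) u v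
                                                                few-both (allowed-bins-sum c))) ⟩
    (121 * (k * k)) ^ t * K      ≡⟨ cong (_* K) (trans (^-distribʳ-* 121 (k * k) t)
                                                       (cong (121 ^ t *_) (^-distribʳ-* k k t))) ⟩
    121 ^ t * (X * X) * K        ≡⟨ shuffle₂ (121 ^ t) (X * X) K ⟩
    121 ^ t * K * (X * X)        ∎)
  where
  open ≤-Reasoning
  X = k ^ t
  K = k ^ w * k ^ n
  C = count (roundCompatible A B c) (hashPairs w n k)
  u = workerBins c
  v = taskBins c
  shuffle₁ : ∀ c a x → c * a * x ≡ a * (c * x)
  shuffle₁ = solve-∀
  shuffle₂ : ∀ a x z → a * x * z ≡ a * z * x
  shuffle₂ = solve-∀

compatible-bound : ∀ {w n k R} .{{_ : NonZero k}} (A : Subset w) (B : Subset n) (cs : Vec (Vec Colour k) R) (t : ℕ) →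
  (∀ i → 10 * bothCount (lookup cs i) ≤ k) → ∣ A ∣ ≡ t → ∣ B ∣ ≡ t →
  count (λ ψs → compatible A B ψs cs) (vectors (hashPairs w n k) R) * (400 ^ t) ^ R
    ≤ (121 ^ t) ^ R * (k ^ w * k ^ n) ^ R
compatible-bound A B []       t few-both ∣A∣≡t ∣B∣≡t = ≤-refl
compatible-bound {w} {n} {k} {suc R} A B (c ∷ cs) t few-both ∣A∣≡t ∣B∣≡t = begin
  count (λ ψs → compatible A B ψs (c ∷ cs)) (vectors (hashPairs w n k) (suc R)) * (α * α ^ R)
    ≡⟨ cong (_* (α * α ^ R)) (count-vectors-∷ (hashPairs w n k) _ (roundCompatible A B c)
                                              (λ ψs → compatible A B ψs cs) (λ _ _ → refl)) ⟩
  C * P * (α * α ^ R)            ≡⟨ interchange C P α (α ^ R) ⟩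
  (C * α) * (P * α ^ R)          ≤⟨ *-mono-≤ (round-bound A B c t (few-both zero) ∣A∣≡t ∣B∣≡t)
                                             (compatible-bound A B cs t (few-both ∘ suc) ∣A∣≡t ∣B∣≡t) ⟩
  (β * K) * (β ^ R * K ^ R)      ≡⟨ interchange β K (β ^ R) (K ^ R) ⟩
  (β * β ^ R) * (K * K ^ R)      ∎
  where
  open ≤-Reasoning
  C = count (roundCompatible A B c) (hashPairs w n k)
  P = count (λ ψs → compatible A B ψs cs) (vectors (hashPairs w n k) R)
  α = 400 ^ t
  β = 121 ^ t
  K = k ^ w * k ^ n
  interchange : ∀ a b c d → a * b * (c * d) ≡ (a * c) * (b * d)
  interchange = solve-∀

-- The union bound

anyList : ∀ {a} {A : Set a} → (A → Bool) → List A → Bool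
anyList P []       = false
anyList P (x ∷ xs) = P x ∨ anyList P xs

anyList-intro : ∀ {a} {A : Set a} (P : A → Bool) {xs : List A} {x} → x ∈ xs → P x ≡ true →
  anyList P xs ≡ true
anyList-intro P (here refl) Px rewrite Px = refl
anyList-intro P {y ∷ xs} (there x∈) Px with P y
... | true  = refl
... | false = anyList-intro P x∈ Px

sumList : ∀ {a} {A : Set a} → (A → ℕ) → List A → ℕ
sumList f []       = 0
sumList f (x ∷ xs) = f x + sumList f xs

count-∨ : ∀ {a} {A : Set a} (P Q : A → Bool) xs → count (λ x → P x ∨ Q x) xs ≤ count P xs + count Q xs
count-∨ P Q []       = z≤n
count-∨ P Q (x ∷ xs) =
  ≤-trans (+-mono-≤ (ind-∨ (P x) (Q x)) (count-∨ P Q xs))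
          (≤-reflexive (+-interchange (ind (P x)) (ind (Q x)) _ _))
  where
  ind-∨ : ∀ a b → ind (a ∨ b) ≤ ind a + ind b
  ind-∨ true  b = s≤s z≤n
  ind-∨ false b = ≤-refl
  +-interchange : ∀ a b c d → a + b + (c + d) ≡ a + c + (b + d)
  +-interchange = solve-∀

union-bound : ∀ {a b} {A : Set a} {I : Set b} (Q : I → A → Bool) (is : List I) xs →
  count (λ x → anyList (λ i → Q i x) is) xs ≤ sumList (λ i → count (Q i) xs) is
union-bound Q []       xs = ≤-reflexive (count-false xs)
  where
  count-false : ∀ {a} {A : Set a} (xs : List A) → count (λ _ → false) xs ≡ 0
  count-false []       = refl
  count-false (x ∷ xs) = count-false xs
union-bound Q (i ∷ is) xs =
  ≤-trans (count-∨ (Q i) (λ x → anyList (λ i → Q i x) is) xs)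
          (+-monoʳ-≤ (count (Q i) xs) (union-bound Q is xs))

sumList-bound : ∀ {a} {A : Set a} (f : A → ℕ) (is : List A) (D bound : ℕ) →
  (∀ i → i ∈ is → f i * D ≤ bound) → sumList f is * D ≤ length is * bound
sumList-bound f []       D bound each = z≤n
sumList-bound f (i ∷ is) D bound each = begin
  (f i + sumList f is) * D       ≡⟨ *-distribʳ-+ D (f i) _ ⟩
  f i * D + sumList f is * D     ≤⟨ +-mono-≤ (each i (here refl)) (sumList-bound f is D bound (λ j j∈ → each j (there j∈))) ⟩
  bound + length is * bound      ∎
  where open ≤-Reasoning

subsetsOfSize : (m t : ℕ) → List (Subset m)
subsetsOfSize zero    zero    = [] ∷ []
subsetsOfSize zero    (suc t) = []
subsetsOfSize (suc m) zero    = map (false ∷_) (subsetsOfSize m zero)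
subsetsOfSize (suc m) (suc t) = map (true ∷_) (subsetsOfSize m t) ++ map (false ∷_) (subsetsOfSize m (suc t))

subsetsOfSize-sound : ∀ m t (A : Subset m) → A ∈ subsetsOfSize m t → ∣ A ∣ ≡ t
subsetsOfSize-sound zero    zero    .[] (here refl) = refl
subsetsOfSize-sound (suc m) zero    A   A∈ with ∈-map⁻ (false ∷_) A∈
... | A′ , A′∈ , refl = subsetsOfSize-sound m zero A′ A′∈
subsetsOfSize-sound (suc m) (suc t) A   A∈ with ∈-++⁻ (map (true ∷_) (subsetsOfSize m t)) A∈
... | inj₁ A∈₁ with ∈-map⁻ (true ∷_) A∈₁
...   | A′ , A′∈ , refl = cong suc (subsetsOfSize-sound m t A′ A′∈)
subsetsOfSize-sound (suc m) (suc t) A   A∈ | inj₂ A∈₂ with ∈-map⁻ (false ∷_) A∈₂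
...   | A′ , A′∈ , refl = subsetsOfSize-sound m (suc t) A′ A′∈

subsetsOfSize-complete : ∀ m t (A : Subset m) → ∣ A ∣ ≡ t → A ∈ subsetsOfSize m t
subsetsOfSize-complete zero    zero    []          ∣A∣≡t = here refl
subsetsOfSize-complete (suc m) zero    (false ∷ A) ∣A∣≡t = ∈-map⁺ (false ∷_) (subsetsOfSize-complete m zero A ∣A∣≡t)
subsetsOfSize-complete (suc m) (suc t) (true ∷ A)  ∣A∣≡t =
  ∈-++⁺ˡ (∈-map⁺ (true ∷_) (subsetsOfSize-complete m t A (suc-injective ∣A∣≡t)))
subsetsOfSize-complete (suc m) (suc t) (false ∷ A) ∣A∣≡t =
  ∈-++⁺ʳ (map (true ∷_) (subsetsOfSize m t)) (∈-map⁺ (false ∷_) (subsetsOfSize-complete m (suc t) A ∣A∣≡t))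

subsetsOfSize-length : ∀ m t → length (subsetsOfSize m t) ≤ m ^ t
subsetsOfSize-length zero    zero    = ≤-refl
subsetsOfSize-length zero    (suc t) = z≤n
subsetsOfSize-length (suc m) zero    =
  subst (_≤ 1) (sym (length-map (false ∷_) (subsetsOfSize m zero))) (subsetsOfSize-length m zero)
subsetsOfSize-length (suc m) (suc t) = begin
  length (map (true ∷_) (subsetsOfSize m t) ++ map (false ∷_) (subsetsOfSize m (suc t)))
    ≡⟨ trans (length-++ (map (true ∷_) (subsetsOfSize m t)))
             (cong₂ _+_ (length-map _ (subsetsOfSize m t)) (length-map _ (subsetsOfSize m (suc t)))) ⟩
  length (subsetsOfSize m t) + length (subsetsOfSize m (suc t))
    ≤⟨ +-mono-≤ (subsetsOfSize-length m t) (subsetsOfSize-length m (suc t)) ⟩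
  m ^ t + m * m ^ t
    ≤⟨ +-mono-≤ m^t≤ (*-monoʳ-≤ m m^t≤) ⟩
  suc m ^ t + m * suc m ^ t ∎
  where
  open ≤-Reasoning
  m^t≤ : m ^ t ≤ suc m ^ t
  m^t≤ = ^-monoˡ-≤ t (n≤1+n m)

∷-⊆ : ∀ {m} {a b} {A W : Subset m} → (a ≡ true → b ≡ true) → A ⊆ W → (a ∷ A) ⊆ (b ∷ W)
∷-⊆ a⇒b A⊆W = ⊆-intro λ { zero a≡ → a⇒b a≡ ; (suc i) i∈ → ⊆-elim A⊆W i i∈ }

subset-of-size : ∀ {m} (W : Subset m) t → t ≤ ∣ W ∣ → Σ (Subset m) (λ A → A ⊆ W × ∣ A ∣ ≡ t)
subset-of-size []          zero    _        = [] , ⊆-refl , refl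
subset-of-size (b ∷ W)     zero    _        with subset-of-size W zero z≤n
... | A , A⊆W , ∣A∣≡0 = false ∷ A , ∷-⊆ (λ ()) A⊆W , ∣A∣≡0
subset-of-size (true ∷ W)  (suc t) (s≤s t≤) with subset-of-size W t t≤
... | A , A⊆W , ∣A∣≡t = true ∷ A , ∷-⊆ id A⊆W , cong suc ∣A∣≡t
subset-of-size (false ∷ W) (suc t) t≤       with subset-of-size W (suc t) t≤
... | A , A⊆W , ∣A∣≡t = false ∷ A , ∷-⊆ id A⊆W , ∣A∣≡t

two-363⁸≤400⁸ : 2 * 363 ^ 8 ≤ 400 ^ 8
two-363⁸≤400⁸ = ≤ᵇ⇒≤ _ _ _

eighth-root : ∀ x y → x ^ 8 ≤ y ^ 8 → x ≤ y
eighth-root x y x⁸≤y⁸ with x ≤? y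
... | yes x≤y = x≤y
... | no  x≰y = contradiction x⁸≤y⁸ (<⇒≱ (^-monoˡ-< 8 (≰⇒> x≰y)))

-- With n^(16+8p) ≤ 2^R, the per-round factor (363/400)^t beats both the n^t · n^t
-- choices of (A , B) and the target probability n^(-p/q).
module Estimate (p q n t R : ℕ) (1≤q : 1 ≤ q) (1≤t : 1 ≤ t) (2≤n : 2 ≤ n)
                (n^a≤2^R : n ^ (16 + 8 * p) ≤ 2 ^ (R * 1)) where

  instance
    n≢0 : NonZero n
    n≢0 = >-nonZero (≤-trans (s≤s z≤n) 2≤n)

  m E : ℕ
  m = t * q
  E = t * (R * q)

  α β : ℕ
  α = (400 ^ t) ^ R
  β = n ^ t * n ^ t * (363 ^ t) ^ R

  α^q : α ^ q ≡ 400 ^ E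
  α^q = trans (^-*-assoc (400 ^ t) R q) (^-*-assoc 400 t (R * q))

  β^q·n^p : β ^ q * n ^ p ≡ n ^ (m + m + p) * 363 ^ E
  β^q·n^p = begin
    (n ^ t * n ^ t * (363 ^ t) ^ R) ^ q * n ^ p
      ≡⟨ cong (_* n ^ p) (trans (^-distribʳ-* (n ^ t * n ^ t) _ q)
                                (cong₂ _*_ (^-distribʳ-* (n ^ t) (n ^ t) q) (^-*-assoc (363 ^ t) R q))) ⟩
    (n ^ t) ^ q * (n ^ t) ^ q * (363 ^ t) ^ (R * q) * n ^ p
      ≡⟨ cong₂ (λ u v → u * u * v * n ^ p) (^-*-assoc n t q) (^-*-assoc 363 t (R * q)) ⟩
    n ^ m * n ^ m * 363 ^ E * n ^ p
      ≡⟨ shuffle (n ^ m) (363 ^ E) (n ^ p) ⟩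
    (n ^ m * n ^ m * n ^ p) * 363 ^ E
      ≡⟨ cong (_* 363 ^ E) (trans (cong (_* n ^ p) (sym (^-distribˡ-+-* n m m)))
                                  (sym (^-distribˡ-+-* n (m + m) p))) ⟩
    n ^ (m + m + p) * 363 ^ E ∎
    where
    open ≡-Reasoning
    shuffle : ∀ x y z → x * x * y * z ≡ (x * x * z) * y
    shuffle = solve-∀

  exponent-bound : (m + m + p) * 8 ≤ (16 + 8 * p) * m
  exponent-bound = begin
    (m + m + p) * 8     ≡⟨ expand m p ⟩
    16 * m + 8 * p * 1  ≤⟨ +-monoʳ-≤ (16 * m) (*-monoʳ-≤ (8 * p) (*-mono-≤ 1≤t 1≤q)) ⟩
    16 * m + 8 * p * m  ≡⟨ sym (*-distribʳ-+ m 16 (8 * p)) ⟩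
    (16 + 8 * p) * m    ∎
    where
    open ≤-Reasoning
    expand : ∀ m p → (m + m + p) * 8 ≡ 16 * m + 8 * p * 1
    expand = solve-∀

  n-part : (n ^ (m + m + p)) ^ 8 ≤ 2 ^ E
  n-part = begin
    (n ^ (m + m + p)) ^ 8     ≡⟨ ^-*-assoc n (m + m + p) 8 ⟩
    n ^ ((m + m + p) * 8)     ≤⟨ ^-monoʳ-≤ n exponent-bound ⟩
    n ^ ((16 + 8 * p) * m)    ≡⟨ sym (^-*-assoc n (16 + 8 * p) m) ⟩
    (n ^ (16 + 8 * p)) ^ m    ≤⟨ ^-monoˡ-≤ m n^a≤2^R ⟩
    (2 ^ (R * 1)) ^ m         ≡⟨ ^-*-assoc 2 (R * 1) m ⟩
    2 ^ (R * 1 * m)           ≡⟨ cong (2 ^_) (regroup t R q) ⟩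
    2 ^ E                     ∎
    where
    open ≤-Reasoning
    regroup : ∀ t R q → R * 1 * (t * q) ≡ t * (R * q)
    regroup = solve-∀

  ratio-bound : β ^ q * n ^ p ≤ α ^ q
  ratio-bound = eighth-root _ _ (begin
    (β ^ q * n ^ p) ^ 8                   ≡⟨ cong (_^ 8) β^q·n^p ⟩
    (n ^ (m + m + p) * 363 ^ E) ^ 8       ≡⟨ ^-distribʳ-* (n ^ (m + m + p)) (363 ^ E) 8 ⟩
    (n ^ (m + m + p)) ^ 8 * (363 ^ E) ^ 8 ≤⟨ *-monoˡ-≤ _ n-part ⟩
    2 ^ E * (363 ^ E) ^ 8                 ≡⟨ cong (2 ^ E *_) (^-swap 363 E 8) ⟩
    2 ^ E * (363 ^ 8) ^ E                 ≡⟨ sym (^-distribʳ-* 2 (363 ^ 8) E) ⟩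
    (2 * 363 ^ 8) ^ E                     ≤⟨ ^-monoˡ-≤ E two-363⁸≤400⁸ ⟩
    (400 ^ 8) ^ E                         ≡⟨ ^-swap 400 8 E ⟩
    (400 ^ E) ^ 8                         ≡⟨ cong (_^ 8) (sym α^q) ⟩
    (α ^ q) ^ 8                           ∎)
    where
    open ≤-Reasoning
    ^-swap : ∀ a i j → (a ^ i) ^ j ≡ (a ^ j) ^ i
    ^-swap a i j = trans (^-*-assoc a i j) (trans (cong (a ^_) (*-comm i j)) (sym (^-*-assoc a j i)))

  conclude : ∀ X Z → X * α ≤ β * Z → X ^ q * n ^ p ≤ Z ^ q
  conclude X Z Xα≤βZ = *-cancelʳ-≤ _ _ (α ^ q) {{α^q≢0}} (begin
    X ^ q * n ^ p * α ^ q      ≡⟨ shuffle₁ (X ^ q) (n ^ p) (α ^ q) ⟩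
    X ^ q * α ^ q * n ^ p      ≡⟨ cong (_* n ^ p) (sym (^-distribʳ-* X α q)) ⟩
    (X * α) ^ q * n ^ p        ≤⟨ *-monoˡ-≤ (n ^ p) (^-monoˡ-≤ q Xα≤βZ) ⟩
    (β * Z) ^ q * n ^ p        ≡⟨ cong (_* n ^ p) (^-distribʳ-* β Z q) ⟩
    β ^ q * Z ^ q * n ^ p      ≡⟨ shuffle₂ (β ^ q) (Z ^ q) (n ^ p) ⟩
    Z ^ q * (β ^ q * n ^ p)    ≤⟨ *-monoʳ-≤ (Z ^ q) ratio-bound ⟩
    Z ^ q * α ^ q              ∎)
    where
    open ≤-Reasoning
    α^q≢0 : NonZero (α ^ q)
    α^q≢0 = m^n≢0 α q {{m^n≢0 (400 ^ t) R {{m^n≢0 400 t}}}}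
    shuffle₁ : ∀ x y z → x * y * z ≡ x * z * y
    shuffle₁ = solve-∀
    shuffle₂ : ∀ x y z → x * y * z ≡ y * (x * z)
    shuffle₂ = solve-∀

-- In a failing run (10|W| ≤ 11k, more than k survivors) every round creates fewer
-- than k/10 'both' bins: s + |W'| ≤ |W| and |W'| ≥ k + 1 force 10 s ≤ k.
few-both-bins : ∀ s k W′ W → s + W′ ≤ W → suc k ≤ W′ → 10 * W ≤ 11 * k → 10 * s ≤ k
few-both-bins s k W′ W s+W′≤W k<W′ 10W≤11k = +-cancelˡ-≤ (10 * k) _ _ (begin
  10 * k + 10 * s      ≤⟨ +-monoˡ-≤ (10 * s) (*-monoʳ-≤ 10 (n≤1+n k)) ⟩
  10 * suc k + 10 * s  ≡⟨ trans (+-comm (10 * suc k) _) (sym (*-distribˡ-+ 10 s (suc k))) ⟩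
  10 * (s + suc k)     ≤⟨ *-monoʳ-≤ 10 (≤-trans (+-monoʳ-≤ s k<W′) s+W′≤W) ⟩
  10 * W               ≤⟨ 10W≤11k ⟩
  11 * k               ≡⟨ eleven k ⟩
  10 * k + k           ∎)
  where
  open ≤-Reasoning
  eleven : ∀ k → 11 * k ≡ 10 * k + k
  eleven = solve-∀

allColours : List Colour
allColours = both ∷ workersOnly ∷ noWorkers ∷ []

colour∈ : ∀ c → c ∈ allColours
colour∈ both        = here refl
colour∈ workersOnly = there (here refl)
colour∈ noWorkers   = there (there (here refl))

module BadSequences (w n k′ R : ℕ) (w≤n : w ≤ n) where
  k t : ℕ
  k = suc k′
  t = suc k

  admissible : Vec Colour k → Bool
  admissible c = 10 * bothCount c ≤ᵇ k

  admissibleColourings : List (Vec Colour k)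
  admissibleColourings = filter (λ c → T? (admissible c)) (vectors allColours k)

  Certificate : Set
  Certificate = Subset w × Subset n × Vec (Vec Colour k) R

  certificates : List Certificate
  certificates = cartesianProduct (subsetsOfSize w t)
                   (cartesianProduct (subsetsOfSize n t) (vectors admissibleColourings R))

  certifies : Certificate → Vec (HashPair w n k) R → Bool
  certifies (A , B , cs) ψs = compatible A B ψs cs

  certified : Vec (HashPair w n k) R → Bool
  certified ψs = anyList (λ x → certifies x ψs) certificates

  allSequences : List (Vec (HashPair w n k) R)
  allSequences = vectors (hashPairs w n k) R

  L : List (Vec (HashPair w n k) R)
  L = filter (λ ψs → T? (certified ψs)) allSequences

  L-unique : Unique L
  L-unique = Uniqueₚ.filter⁺ (λ ψs → T? (certified ψs))
    (vectors-unique R (Uniqueₚ.cartesianProduct⁺ (vectors-unique w (Uniqueₚ.allFin⁺ k))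
                                                 (vectors-unique n (Uniqueₚ.allFin⁺ k))))

  sequence-listed : (ψs : Vec (HashPair w n k) R) → ψs ∈ allSequences
  sequence-listed ψs = vectors-complete ψs (λ i → pair-listed (lookup ψs i))
    where
    pair-listed : (ψ : HashPair w n k) → ψ ∈ hashPairs w n k
    pair-listed (h₁ , h₂) = ∈-cartesianProduct⁺ (vectors-complete h₁ (λ _ → ∈-allFin _))
                                                (vectors-complete h₂ (λ _ → ∈-allFin _))

  -- Too many survivors yield a certificate, so uncertified sequences are k-halving.
  uncertified⇒halving : (ψs : Vec (HashPair w n k) R) → certified ψs ≡ false → KHalving ψs
  uncertified⇒halving ψs uncertified W₀ T₀ ∣W₀∣≡∣T₀∣ 10W≤11k with ∣ finalW ψs (W₀ , T₀) ∣ ≤? k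
  ... | yes few = run-balanced ψs W₀ T₀ ∣W₀∣≡∣T₀∣ , few
  ... | no  many = contradiction (trans (sym (anyList-intro _ cert∈ compatible-cs)) uncertified) λ ()
    where
    t≤W′ : t ≤ ∣ finalW ψs (W₀ , T₀) ∣
    t≤W′ = ≰⇒> many
    t≤T′ : t ≤ ∣ finalT ψs (W₀ , T₀) ∣
    t≤T′ = subst (t ≤_) (run-balanced ψs W₀ T₀ ∣W₀∣≡∣T₀∣) t≤W′
    A = subset-of-size (finalW ψs (W₀ , T₀)) t t≤W′
    B = subset-of-size (finalT ψs (W₀ , T₀)) t t≤T′
    cert = certificate ψs W₀ T₀ (proj₁ A) (proj₁ B) (proj₁ (proj₂ A)) (proj₁ (proj₂ B))
    cs = proj₁ cert
    compatible-cs : compatible (proj₁ A) (proj₁ B) ψs cs ≡ true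
    compatible-cs = proj₁ (proj₂ cert)
    cs-admissible : ∀ i → T (admissible (lookup cs i))
    cs-admissible i = ≤⇒≤ᵇ (few-both-bins _ k _ _ (proj₂ (proj₂ cert) i) t≤W′ 10W≤11k)
    cs∈ : cs ∈ vectors admissibleColourings R
    cs∈ = vectors-complete cs (λ i → ∈-filter⁺ (λ c → T? (admissible c))
                                      (vectors-complete (lookup cs i) (colour∈ ∘ lookup (lookup cs i)))
                                      (cs-admissible i))
    cert∈ : (proj₁ A , proj₁ B , cs) ∈ certificates
    cert∈ = ∈-cartesianProduct⁺ (subsetsOfSize-complete w t _ (proj₂ (proj₂ A)))
              (∈-cartesianProduct⁺ (subsetsOfSize-complete n t _ (proj₂ (proj₂ B))) cs∈)

  bad∈L : (ψs : Vec (HashPair w n k) R) → ¬ KHalving ψs → ψs ∈ L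
  bad∈L ψs not-halving = ∈-filter⁺ (λ ψs → T? (certified ψs)) (sequence-listed ψs) (is-certified (certified ψs) refl)
    where
    is-certified : (b : Bool) → certified ψs ≡ b → T (certified ψs)
    is-certified true  eq rewrite eq = tt
    is-certified false eq = contradiction (uncertified⇒halving ψs eq) not-halving

  Z : ℕ
  Z = (k ^ w * k ^ n) ^ R

  certified-count : ∀ x → x ∈ certificates →
    count (certifies x) allSequences * (400 ^ t) ^ R ≤ (121 ^ t) ^ R * Z
  certified-count (A , B , cs) x∈ with ∈-cartesianProduct⁻ (subsetsOfSize w t) _ x∈
  ... | A∈ , BC∈ with ∈-cartesianProduct⁻ (subsetsOfSize n t) (vectors admissibleColourings R) BC∈
  ...   | B∈ , cs∈ = compatible-bound A B cs t cs-admissible (subsetsOfSize-sound w t A A∈)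
                                                             (subsetsOfSize-sound n t B B∈)
    where
    cs-admissible : ∀ i → 10 * bothCount (lookup cs i) ≤ k
    cs-admissible i = ≤ᵇ⇒≤ _ _ (proj₂ (∈-filter⁻ (λ c → T? (admissible c)) {xs = vectors allColours k}
                                              (vectors-sound admissibleColourings cs cs∈ i)))

  certificates-length : length certificates ≤ n ^ t * (n ^ t * (3 ^ k) ^ R)
  certificates-length = begin
    length certificates
      ≡⟨ length-cartesianProductWith _,_ (subsetsOfSize w t) _ ⟩
    length (subsetsOfSize w t) * length (cartesianProduct (subsetsOfSize n t) (vectors admissibleColourings R))
      ≡⟨ cong (length (subsetsOfSize w t) *_)
              (trans (length-cartesianProductWith _,_ (subsetsOfSize n t) (vectors admissibleColourings R))
                     (cong (length (subsetsOfSize n t) *_) (vectors-length admissibleColourings R))) ⟩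
    length (subsetsOfSize w t) * (length (subsetsOfSize n t) * length admissibleColourings ^ R)
      ≤⟨ *-mono-≤ (≤-trans (subsetsOfSize-length w t) (^-monoˡ-≤ t w≤n))
                  (*-mono-≤ (subsetsOfSize-length n t) (^-monoˡ-≤ R colourings-length)) ⟩
    n ^ t * (n ^ t * (3 ^ k) ^ R) ∎
    where
    open ≤-Reasoning
    colourings-length : length admissibleColourings ≤ 3 ^ k
    colourings-length = subst (length admissibleColourings ≤_) (vectors-length allColours k)
                              (length-filter (λ c → T? (admissible c)) (vectors allColours k))

  L-bound : length L * (400 ^ t) ^ R ≤ (n ^ t * n ^ t * (363 ^ t) ^ R) * Z
  L-bound = begin
    length L * α
      ≡⟨ cong (_* α) (length-filter≡count certified allSequences) ⟩
    count certified allSequences * α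
      ≤⟨ *-monoˡ-≤ α (union-bound certifies certificates allSequences) ⟩
    sumList (λ x → count (certifies x) allSequences) certificates * α
      ≤⟨ sumList-bound _ certificates α ((121 ^ t) ^ R * Z) certified-count ⟩
    length certificates * ((121 ^ t) ^ R * Z)
      ≤⟨ *-monoˡ-≤ _ certificates-length ⟩
    (n ^ t * (n ^ t * (3 ^ k) ^ R)) * ((121 ^ t) ^ R * Z)
      ≡⟨ regroup (n ^ t) ((3 ^ k) ^ R) ((121 ^ t) ^ R) Z ⟩
    n ^ t * n ^ t * ((3 ^ k) ^ R * (121 ^ t) ^ R) * Z
      ≤⟨ *-monoˡ-≤ Z (*-monoʳ-≤ (n ^ t * n ^ t) colour-factor) ⟩
    (n ^ t * n ^ t * (363 ^ t) ^ R) * Z ∎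
    where
    open ≤-Reasoning
    α = (400 ^ t) ^ R
    regroup : ∀ a b c z → (a * (a * b)) * (c * z) ≡ a * a * (b * c) * z
    regroup = solve-∀
    colour-factor : (3 ^ k) ^ R * (121 ^ t) ^ R ≤ (363 ^ t) ^ R
    colour-factor = begin
      (3 ^ k) ^ R * (121 ^ t) ^ R  ≡⟨ sym (^-distribʳ-* (3 ^ k) (121 ^ t) R) ⟩
      (3 ^ k * 121 ^ t) ^ R        ≤⟨ ^-monoˡ-≤ R (*-monoˡ-≤ (121 ^ t) (^-monoʳ-≤ 3 (n≤1+n k))) ⟩
      (3 ^ t * 121 ^ t) ^ R        ≡⟨ cong (_^ R) (sym (^-distribʳ-* 3 121 t)) ⟩
      (363 ^ t) ^ R                ∎

lemma9 : (p q : ℕ) → 1 ≤ p → 1 ≤ q →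
    ∃[ a ] ∃[ b ] (1 ≤ a × 1 ≤ b ×
    ((n w k R : ℕ) → 2 ≤ n → 1 ≤ w → w ≤ n → 1 ≤ k → IsCeilCLog a b n R →
    ∃[ L ] (Unique L ×
    ((ψs : Vec (HashPair w n k) R) → ¬ KHalving ψs → ψs ∈ L) ×
    (length L ^ q * n ^ p ≤ ((k ^ w * k ^ n) ^ R) ^ q))))
lemma9 p q _ 1≤q = 16 + 8 * p , 1 , s≤s z≤n , s≤s z≤n , bad-sequences-rare
  where
  bad-sequences-rare : (n w k R : ℕ) → 2 ≤ n → 1 ≤ w → w ≤ n → 1 ≤ k → IsCeilCLog (16 + 8 * p) 1 n R →
    ∃[ L ] (Unique L ×
    ((ψs : Vec (HashPair w n k) R) → ¬ KHalving ψs → ψs ∈ L) ×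
    (length L ^ q * n ^ p ≤ ((k ^ w * k ^ n) ^ R) ^ q))
  bad-sequences-rare n w (suc k′) R 2≤n _ w≤n _ (n^a≤2^R , _) =
    Bad.L , Bad.L-unique , Bad.bad∈L , Est.conclude (length Bad.L) Bad.Z Bad.L-bound
    where
    module Bad = BadSequences w n k′ R w≤n
    module Est = Estimate p q n Bad.t R 1≤q (s≤s z≤n) 2≤n n^a≤2^R
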